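{- Let $G$ be a graph and $X,Y$ disjoint subsets of $V(G)$ such that $G$ is $X$–$Y$ normalized. Let $S\subseteq N(X)$ and assume that no vertex of $S$ is adjacent to a vertex of $Y$. Then there is exactly one important witness of $S$.
   Context: All graphs are finite, simple and undirected. $G\setminus C$ is the subgraph induced by $V(G)\setminus C$; $N(C)=(\bigcup_{v\in C}N(v))\setminus C$. An $X$–$Y$ separator is a set $K\subseteq V(G)\setminus(X\cup Y)$ such that $G\setminus K$ has no path from $X$ to $Y$; minimal means inclusion-minimal, smallest means of minimum cardinality. $NR(G,A,B)$ is the set of vertices of $G\setminus B$ not reachable from $A$ in $G\setminus B$. $K'>K$ means $NR(G,Y,K')\supsetneq NR(G,Y,K)$. A minimal $X$–$Y$ separator $K$ is important if no $X$–$Y$ separator $K'$ satisfies $K'>K$ and $|K'|\le|K|$. The excess of an $X$–$Y$ separator $K$ is $|K|-r$, where $r$ is the minimum size of an $X$–$Y$ separator. $G$ is $X$–$Y$ normalized if $N(X)$ is the only smallest $X$–$Y$ separator. For $S\subseteq N(X)$ not adjacent to $Y$, the cover excess $CE(S)$ is the excess of a smallest $X$–$Y$ separator disjoint from $S$; a witness of $S$ is an $X$–$Y$ separator $K$ with $S\cap K=\emptyset$ and excess equal to $CE(S)$; an important witness of $S$ is a witness of $S$ that is an important $X$–$Y$ separator of $G$. -}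

module Defs where

open import Data.Nat using (ℕ; zero; suc; _≤_; _∸_)
open import Data.Bool using (Bool; true; false; _∧_; _∨_; not)
open import Data.Fin using (Fin; zero; suc)
open import Data.Fin.Subset using (Subset; _∈_; _∉_; _⊆_; _⊂_; ∣_∣)
open import Data.Vec using (tabulate; lookup)
open import Data.Product using (Σ; ∃; _×_; _,_)
open import Relation.Binary.PropositionalEquality using (_≡_)
open import Relation.Nullary using (¬_)

record Graph (n : ℕ) : Set where
  field
    adj    : Fin n → Fin n → Bool
    sym    : ∀ u v → adj u v ≡ adj v u
    irrefl : ∀ v → adj v v ≡ false
open Graph public

module _ {n : ℕ} (G : Graph n) where

  anyᵇ : ∀ {m} → (Fin m → Bool) → Bool
  anyᵇ {zero}  f = false
  anyᵇ {suc m} f = f zero ∨ anyᵇ (λ i → f (suc i))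

  Nbh : Subset n → Subset n
  Nbh C = tabulate λ v → not (lookup C v) ∧ anyᵇ (λ u → lookup C u ∧ adj G u v)

  Disjoint : Subset n → Subset n → Set
  Disjoint A B = ∀ v → v ∈ A → v ∉ B

  data Walk (K : Subset n) : Fin n → Fin n → Set where
    here : ∀ {u} → u ∉ K → Walk K u u
    step : ∀ {u w v} → u ∉ K → adj G u w ≡ true → Walk K w v → Walk K u v

  PathAvoiding : Subset n → Subset n → Subset n → Set
  PathAvoiding K A B = Σ (Fin n) λ a → Σ (Fin n) λ b → a ∈ A × b ∈ B × Walk K a b

  Separator : Subset n → Subset n → Subset n → Set
  Separator X Y K = Disjoint K X × Disjoint K Y × ¬ PathAvoiding K X Y

  MinimalSeparator : Subset n → Subset n → Subset n → Set
  MinimalSeparator X Y K =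
    Separator X Y K × (∀ K' → K' ⊂ K → ¬ Separator X Y K')

  SmallestSeparator : Subset n → Subset n → Subset n → Set
  SmallestSeparator X Y K =
    Separator X Y K × (∀ K' → Separator X Y K' → ∣ K ∣ ≤ ∣ K' ∣)

  NR : Subset n → Subset n → Fin n → Set
  NR A B v = v ∉ B × ¬ (Σ (Fin n) λ a → a ∈ A × Walk B a v)

  Greater : Subset n → Subset n → Subset n → Set
  Greater Y K' K =
    (∀ v → NR Y K v → NR Y K' v) × (Σ (Fin n) λ v → NR Y K' v × ¬ NR Y K v)

  ImportantSeparator : Subset n → Subset n → Subset n → Set
  ImportantSeparator X Y K =
    MinimalSeparator X Y K ×
    ¬ (Σ (Subset n) λ K' → Separator X Y K' × Greater Y K' K × ∣ K' ∣ ≤ ∣ K ∣)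

  MinSepSize : Subset n → Subset n → ℕ → Set
  MinSepSize X Y r =
    (Σ (Subset n) λ K → Separator X Y K × ∣ K ∣ ≡ r) ×
    (∀ K → Separator X Y K → r ≤ ∣ K ∣)

  Excess : Subset n → Subset n → Subset n → ℕ → Set
  Excess X Y K e = Separator X Y K × Σ ℕ λ r → MinSepSize X Y r × e ≡ ∣ K ∣ ∸ r

  Normalized : Subset n → Subset n → Set
  Normalized X Y =
    SmallestSeparator X Y (Nbh X) × (∀ K → SmallestSeparator X Y K → K ≡ Nbh X)

  CoverExcess : Subset n → Subset n → Subset n → ℕ → Set
  CoverExcess X Y S c =
    Σ (Subset n) λ K →
      (Separator X Y K × Disjoint S K ×
        (∀ K' → Separator X Y K' → Disjoint S K' → ∣ K ∣ ≤ ∣ K' ∣)) ×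
      Excess X Y K c

  Witness : Subset n → Subset n → Subset n → Subset n → Set
  Witness X Y S K =
    Separator X Y K × Disjoint S K ×
    (Σ ℕ λ c → CoverExcess X Y S c × Excess X Y K c)

  ImportantWitness : Subset n → Subset n → Subset n → Subset n → Set
  ImportantWitness X Y S K = Witness X Y S K × ImportantSeparator X Y K

module Submission where

-- For an X–Y separator K write side(K) = NR(G,Y,K) for the part of G∖K that Y
-- cannot reach.  side(K) contains X, avoids Y, and N(side K) ⊆ K; a minimal
-- separator is therefore K = N(side K), so it is determined by its side.
--
-- Let K₁, K₂ be important witnesses of S, with sides A₁, A₂; both
-- contain S.  Since |N(·)| is submodular, |N(A₁∪A₂)| + |N(A₁∩A₂)| ≤ |K₁| + |K₂|.
-- N(A₁∩A₂) is a separator avoiding S, so it is no smaller than the witness K₂;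
-- hence |N(A₁∪A₂)| ≤ |K₁|.  If A₂ ⊄ A₁, then N(A₁∪A₂) > K₁, contradicting the
-- importance of K₁.  So A₁ = A₂ and K₁ = K₂.
--
-- N(Y) is a separator avoiding S, so there is a smallest separator
-- avoiding S; among the separators avoiding S of that size choose one whose side
-- is maximal under strict inclusion.  It is a witness, minimal, and important.

open import Defs hiding (sym)
open import Data.Nat using (ℕ; zero; suc; _≤_; _<_; _+_; _∸_; z≤n; s≤s; _<?_; _≤?_)
open import Data.Nat.Properties
  using (+-commutativeSemigroup; ≤-refl; ≤-trans; ≤-antisym; +-suc; +-identityʳ;
         +-mono-≤; +-monoʳ-≤; +-monoˡ-≤; +-cancelʳ-≤; m≤n+m; ≮⇒≥; <⇒≱; ∸-monoʳ-<; ∸-cancelʳ-≡; module ≤-Reasoning)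
open import Data.Nat.Induction using (<-wellFounded)
open import Algebra.Properties.CommutativeSemigroup +-commutativeSemigroup using (interchange)
open import Data.Bool using (Bool; true; false; T; _∧_)
open import Data.Bool.Properties using (T-≡; T-∧; T-∨; T-not-≡) renaming (_≟_ to _≟ᵇ_)
open import Data.Fin using (Fin; zero; suc)
open import Data.Fin.Properties using (any?; all?) renaming (_≟_ to _≟ᶠ_)
open import Data.Fin.Subset using (Subset; _∈_; _∉_; _⊆_; _⊂_; ∣_∣; _∪_; _∩_; ⁅_⁆; ⊤)
open import Data.Fin.Subset.Properties
  using (_∈?_; _⊂?_; anySubset?; p⊂q⇒∣p∣<∣q∣; p⊆q⇒∣p∣≤∣q∣; ⊆-antisym; ∣p∣≤n; ∣p∣≡n⇒p≡⊤; ∈⊤;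
         x∈p∪q⁻; x∈p∪q⁺; x∈p∩q⁻; x∈p∩q⁺; p⊆p∪q; x∈⁅x⁆; x∈⁅y⁆⇒x≡y)
open import Data.Vec using ([]; _∷_; tabulate; lookup; here; there)
open import Data.Vec.Properties using (lookup∘tabulate; []=⇒lookup; lookup⇒[]=)
open import Data.Product using (Σ; ∃; _×_; _,_; proj₁; proj₂) renaming (map to map-×)
open import Data.Sum using (_⊎_; inj₁; inj₂) renaming (map to map-⊎)
open import Data.Empty using (⊥; ⊥-elim)
open import Function.Bundles using (Equivalence)
open import Induction.WellFounded using (Acc; acc)
open import Relation.Binary.PropositionalEquality using (_≡_; refl; sym; trans; cong; subst; module ≡-Reasoning)
open import Relation.Nullary using (¬_; Dec; yes; no)
open import Relation.Nullary.Decidable using (isYes; map′; _×-dec_; ¬?; _→-dec_; toWitness; fromWitness)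
open import Relation.Unary using (Decidable)

∈-tabulate⁻ : ∀ {m} {f : Fin m → Bool} {v} → v ∈ tabulate f → T (f v)
∈-tabulate⁻ {f = f} {v} v∈ =
  Equivalence.from T-≡ (trans (sym (lookup∘tabulate f v)) ([]=⇒lookup v∈))

∈-tabulate⁺ : ∀ {m} {f : Fin m → Bool} {v} → T (f v) → v ∈ tabulate f
∈-tabulate⁺ {f = f} {v} t =
  lookup⇒[]= v (tabulate f) (trans (lookup∘tabulate f v) (Equivalence.to T-≡ t))

⟦_⟧ : ∀ {m} {P : Fin m → Set} → Decidable P → Subset m
⟦ P? ⟧ = tabulate (λ v → isYes (P? v))

∈⟦⟧⁻ : ∀ {m} {P : Fin m → Set} (P? : Decidable P) {v} → v ∈ ⟦ P? ⟧ → P v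
∈⟦⟧⁻ P? {v} v∈ = toWitness {a? = P? v} (∈-tabulate⁻ v∈)

∈⟦⟧⁺ : ∀ {m} {P : Fin m → Set} (P? : Decidable P) {v} → P v → v ∈ ⟦ P? ⟧
∈⟦⟧⁺ P? {v} p = ∈-tabulate⁺ (fromWitness {a? = P? v} p)

bit : Bool → ℕ
bit true  = 1
bit false = 0

∣∷∣ : ∀ {m} x (p : Subset m) → ∣ x ∷ p ∣ ≡ bit x + ∣ p ∣
∣∷∣ true  p = refl
∣∷∣ false p = refl

bit-submodular : ∀ u i a b → (u ≡ true → i ≡ true → a ≡ true × b ≡ true) →
  (u ≡ true → a ≡ true ⊎ b ≡ true) → (i ≡ true → a ≡ true ⊎ b ≡ true) →
  bit u + bit i ≤ bit a + bit b
bit-submodular true  true  a b both _ _ with both refl refl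
... | refl , refl = ≤-refl
bit-submodular true  false a b _ one _ with one refl
... | inj₁ refl = s≤s z≤n
... | inj₂ refl = m≤n+m 1 (bit a)
bit-submodular false true  a b _ _ one with one refl
... | inj₁ refl = s≤s z≤n
... | inj₂ refl = m≤n+m 1 (bit a)
bit-submodular false false a b _ _ _ = z≤n

card-submodular : ∀ {m} (u i a b : Subset m) →
  (∀ {x} → x ∈ u → x ∈ i → x ∈ a × x ∈ b) →
  (∀ {x} → x ∈ u → x ∈ a ⊎ x ∈ b) → (∀ {x} → x ∈ i → x ∈ a ⊎ x ∈ b) →
  ∣ u ∣ + ∣ i ∣ ≤ ∣ a ∣ + ∣ b ∣
card-submodular [] [] [] [] _ _ _ = z≤n
card-submodular (u₀ ∷ u) (i₀ ∷ i) (a₀ ∷ a) (b₀ ∷ b) both inU inI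
  rewrite ∣∷∣ u₀ u | ∣∷∣ i₀ i | ∣∷∣ a₀ a | ∣∷∣ b₀ b
        | interchange (bit u₀) (∣ u ∣) (bit i₀) (∣ i ∣) | interchange (bit a₀) (∣ a ∣) (bit b₀) (∣ b ∣)
  = +-mono-≤ (bit-submodular u₀ i₀ a₀ b₀
                (λ { refl refl → map-× head head (both here here) })
                (λ { refl → map-⊎ head head (inU here) }) (λ { refl → map-⊎ head head (inI here) }))
             (card-submodular u i a b
                (λ x∈u x∈i → map-× tail tail (both (there x∈u) (there x∈i)))
                (λ x∈u → map-⊎ tail tail (inU (there x∈u))) (λ x∈i → map-⊎ tail tail (inI (there x∈i))))
  where
  head : ∀ {x : Bool} {m} {p : Subset m} → zero ∈ (x ∷ p) → x ≡ true
  head here = refl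
  tail : ∀ {x : Bool} {m} {p : Subset m} {v} → suc v ∈ (x ∷ p) → v ∈ p
  tail (there v∈) = v∈

module _ {m : ℕ} {P : Subset m → Set} (P? : Decidable P)
         {_≺_ : Subset m → Subset m → Set} (≺? : ∀ a b → Dec (a ≺ b))
         (μ : Subset m → ℕ) (μ-mono : ∀ {a b} → a ≺ b → μ a < μ b) where

  ≺-minimal : ∀ {a} → P a → ∃ λ o → P o × (∀ b → P b → ¬ b ≺ o)
  ≺-minimal {a} pa = descend a (<-wellFounded (μ a)) pa
    where
    descend : ∀ a → Acc _<_ (μ a) → P a → ∃ λ o → P o × (∀ b → P b → ¬ b ≺ o)
    descend a (acc below) pa with anySubset? (λ b → P? b ×-dec ≺? b a)
    ... | yes (b , pb , b≺a) = descend b (below (μ-mono b≺a)) pb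
    ... | no none            = a , pa , λ b pb b≺a → none (b , pb , b≺a)

module _ {n : ℕ} (G : Graph n) where

  adj-sym : ∀ {u v} → adj G u v ≡ true → adj G v u ≡ true
  adj-sym {u} {v} e = trans (Graph.sym G v u) e

  anyᵇ-elim : ∀ {m} (f : Fin m → Bool) → T (anyᵇ G f) → ∃ λ i → T (f i)
  anyᵇ-elim {suc m} f t with Equivalence.to T-∨ t
  ... | inj₁ t₀ = zero , t₀
  ... | inj₂ t₁ with anyᵇ-elim (λ i → f (suc i)) t₁
  ... | i , tᵢ = suc i , tᵢ

  anyᵇ-intro : ∀ {m} (f : Fin m → Bool) i → T (f i) → T (anyᵇ G f)
  anyᵇ-intro f zero    t = Equivalence.from T-∨ (inj₁ t)
  anyᵇ-intro f (suc i) t = Equivalence.from T-∨ (inj₂ (anyᵇ-intro (λ j → f (suc j)) i t))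

  Nbh-elim : ∀ {C v} → v ∈ Nbh G C → v ∉ C × ∃ λ u → u ∈ C × adj G u v ≡ true
  Nbh-elim {C} {v} v∈N with Equivalence.to T-∧ (∈-tabulate⁻ v∈N)
  ... | v∉C , t with anyᵇ-elim (λ u → lookup C u ∧ adj G u v) t
  ... | u , tᵤ with Equivalence.to T-∧ tᵤ
  ... | u∈C , e =
    (λ v∈C → outside (Equivalence.to T-not-≡ v∉C) ([]=⇒lookup v∈C)) ,
    u , lookup⇒[]= u C (Equivalence.to T-≡ u∈C) , Equivalence.to T-≡ e
    where
    outside : ∀ {b : Bool} → b ≡ false → b ≡ true → ⊥
    outside refl ()

  Nbh-intro : ∀ {C v u} → v ∉ C → u ∈ C → adj G u v ≡ true → v ∈ Nbh G C
  Nbh-intro {C} {v} {u} v∉C u∈C e = ∈-tabulate⁺ (Equivalence.from T-∧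
    (Equivalence.from T-not-≡ (lookup-false v∉C) ,
     anyᵇ-intro (λ w → lookup C w ∧ adj G w v) u
       (Equivalence.from T-∧ (Equivalence.from T-≡ ([]=⇒lookup u∈C) , Equivalence.from T-≡ e))))
    where
    lookup-false : ∀ {x} → x ∉ C → lookup C x ≡ false
    lookup-false {x} x∉C with lookup C x in eq
    ... | true  = ⊥-elim (x∉C (lookup⇒[]= x C eq))
    ... | false = refl

  walk-start : ∀ {K a b} → Walk G K a b → a ∉ K
  walk-start (here a∉K)     = a∉K
  walk-start (step a∉K _ _) = a∉K

  weaken : ∀ {K K' a b} → K' ⊆ K → Walk G K a b → Walk G K' a b
  weaken K'⊆K (here a∉K)     = here (λ a∈K' → a∉K (K'⊆K a∈K'))
  weaken K'⊆K (step a∉K e w) = step (λ a∈K' → a∉K (K'⊆K a∈K')) e (weaken K'⊆K w)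

  snoc : ∀ {K a v u} → Walk G K a v → adj G v u ≡ true → u ∉ K → Walk G K a u
  snoc (here a∉K)      e u∉K = step a∉K e (here u∉K)
  snoc (step a∉K e' w) e u∉K = step a∉K e' (snoc w e u∉K)

  reverse : ∀ {K a b} → Walk G K a b → Walk G K b a
  reverse (here a∉K)     = here a∉K
  reverse (step a∉K e w) = snoc (reverse w) (adj-sym e) a∉K

  ∉∪⁅⁆ : ∀ {K : Subset n} {a u} → u ∉ K → ¬ u ≡ a → u ∉ K ∪ ⁅ a ⁆
  ∉∪⁅⁆ {K} {a} u∉K u≢a u∈ with x∈p∪q⁻ K ⁅ a ⁆ u∈
  ... | inj₁ u∈K = u∉K u∈K
  ... | inj₂ u∈a = u≢a (x∈⁅y⁆⇒x≡y a u∈a)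

  last-visit : ∀ {K u b} a → Walk G K u b →
    Walk G (K ∪ ⁅ a ⁆) u b ⊎ (a ≡ b ⊎ ∃ λ w → adj G a w ≡ true × Walk G (K ∪ ⁅ a ⁆) w b)
  last-visit {u = u} a (here u∉K) with u ≟ᶠ a
  ... | yes refl = inj₂ (inj₁ refl)
  ... | no u≢a   = inj₁ (here (∉∪⁅⁆ u∉K u≢a))
  last-visit {u = u} a (step {w = w} u∉K e rest) with last-visit a rest
  ... | inj₂ later = inj₂ later
  ... | inj₁ rest' with u ≟ᶠ a
  ... | yes refl = inj₂ (inj₂ (w , e , rest'))
  ... | no u≢a   = inj₁ (step (∉∪⁅⁆ u∉K u≢a) e rest')

  -- Walks are decidable: a walk from a ≠ b leaves a through a neighbour and never
  -- needs to return, so we may recurse with a added to the forbidden set, whose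
  -- size bounds the recursion.
  walk?′ : (fuel : ℕ) (K : Subset n) → n ≤ ∣ K ∣ + fuel → ∀ a b → Dec (Walk G K a b)
  walk?′ zero K full a b = no λ w → walk-start w (subst (a ∈_) (sym K≡⊤) ∈⊤)
    where
    K≡⊤ : K ≡ ⊤
    K≡⊤ = ∣p∣≡n⇒p≡⊤ (≤-antisym (∣p∣≤n K) (subst (n ≤_) (+-identityʳ _) full))
  walk?′ (suc fuel) K full a b with a ∈? K
  ... | yes a∈K = no λ w → walk-start w a∈K
  ... | no a∉K with a ≟ᶠ b
  ... | yes refl = yes (here a∉K)
  ... | no a≢b = map′ leave enter
                   (any? λ w → (adj G a w ≟ᵇ true) ×-dec walk?′ fuel (K ∪ ⁅ a ⁆) full′ w b)
    where
    K⊂ : K ⊂ K ∪ ⁅ a ⁆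
    K⊂ = p⊆p∪q ⁅ a ⁆ , a , x∈p∪q⁺ (inj₂ (x∈⁅x⁆ a)) , a∉K
    full′ : n ≤ ∣ K ∪ ⁅ a ⁆ ∣ + fuel
    full′ = ≤-trans full (subst (_≤ ∣ K ∪ ⁅ a ⁆ ∣ + fuel) (sym (+-suc ∣ K ∣ fuel))
                            (+-monoˡ-≤ fuel (p⊂q⇒∣p∣<∣q∣ K⊂)))
    leave : (∃ λ w → adj G a w ≡ true × Walk G (K ∪ ⁅ a ⁆) w b) → Walk G K a b
    leave (w , e , rest) = step a∉K e (weaken (p⊆p∪q ⁅ a ⁆) rest)
    enter : Walk G K a b → ∃ λ w → adj G a w ≡ true × Walk G (K ∪ ⁅ a ⁆) w b
    enter walk with last-visit a walk
    ... | inj₁ avoid         = ⊥-elim (walk-start avoid (x∈p∪q⁺ (inj₂ (x∈⁅x⁆ a))))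
    ... | inj₂ (inj₁ a≡b)    = ⊥-elim (a≢b a≡b)
    ... | inj₂ (inj₂ leaves) = leaves

  walk? : ∀ K a b → Dec (Walk G K a b)
  walk? K = walk?′ n K (m≤n+m n ∣ K ∣)

  exit : ∀ {K C u v} → Walk G K u v → u ∈ C → v ∉ C → ∃ λ w → w ∈ Nbh G C × w ∉ K
  exit (here _) u∈C u∉C = ⊥-elim (u∉C u∈C)
  exit {C = C} (step {w = w} _ e rest) u∈C v∉C with w ∈? C
  ... | yes w∈C = exit rest w∈C v∉C
  ... | no w∉C  = w , Nbh-intro w∉C u∈C e , walk-start rest

  separator-sym : ∀ {X Y K} → Separator G X Y K → Separator G Y X K
  separator-sym (K∩X , K∩Y , no-path) =
    K∩Y , K∩X , λ (a , b , a∈Y , b∈X , w) → no-path (b , a , b∈X , a∈Y , reverse w)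

  Nbh-separator : ∀ {X Y C} → X ⊆ C → Disjoint G Y C → Disjoint G (Nbh G C) Y →
    Separator G X Y (Nbh G C)
  Nbh-separator {X} {Y} {C} X⊆C Y∩C N∩Y =
    (λ v v∈N v∈X → proj₁ (Nbh-elim v∈N) (X⊆C v∈X)) , N∩Y ,
    λ (a , b , a∈X , b∈Y , w) → let (_ , w∈N , w∉N) = exit w (X⊆C a∈X) (Y∩C b b∈Y) in w∉N w∈N

  NR-Nbh : ∀ {Y C w} → Disjoint G Y C → w ∈ C → NR G Y (Nbh G C) w
  NR-Nbh Y∩C w∈C =
    (λ w∈N → proj₁ (Nbh-elim w∈N) w∈C) ,
    λ (a , a∈Y , walk) → let (_ , x∈N , x∉N) = exit (reverse walk) w∈C (Y∩C a a∈Y) in x∉N x∈N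

  NR? : ∀ Y K → Decidable (NR G Y K)
  NR? Y K v = ¬? (v ∈? K) ×-dec ¬? (any? λ a → (a ∈? Y) ×-dec walk? K a v)

  side : Subset n → Subset n → Subset n
  side Y K = ⟦ NR? Y K ⟧

  module Side {X Y K : Subset n} (sep : Separator G X Y K) where

    X⊆side : X ⊆ side Y K
    X⊆side {x} x∈X = ∈⟦⟧⁺ (NR? Y K)
      ((λ x∈K → proj₁ sep x x∈K x∈X) ,
       λ (a , a∈Y , walk) → proj₂ (proj₂ sep) (x , a , x∈X , a∈Y , reverse walk))

    Y∩side : Disjoint G Y (side Y K)
    Y∩side y y∈Y y∈A =
      proj₂ (∈⟦⟧⁻ (NR? Y K) y∈A) (y , y∈Y , here (λ y∈K → proj₁ (proj₂ sep) y y∈K y∈Y))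

    side-closed : ∀ {u w} → u ∈ side Y K → adj G u w ≡ true → w ∉ K → w ∈ side Y K
    side-closed u∈A e w∉K = ∈⟦⟧⁺ (NR? Y K) (w∉K , λ (a , a∈Y , walk) →
      let (u∉K , unreachable) = ∈⟦⟧⁻ (NR? Y K) u∈A
      in unreachable (a , a∈Y , snoc walk (adj-sym e) u∉K))

    Nbh-side⊆ : Nbh G (side Y K) ⊆ K
    Nbh-side⊆ {v} v∈N with v ∈? K | Nbh-elim v∈N
    ... | yes v∈K | _                    = v∈K
    ... | no v∉K  | (v∉A , u , u∈A , e) = ⊥-elim (v∉A (side-closed u∈A e v∉K))

    no-edge-to-Y : ∀ {u v} → u ∈ side Y K → v ∈ Y → adj G u v ≡ true → ⊥
    no-edge-to-Y u∈A v∈Y e =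
      Y∩side _ v∈Y (side-closed u∈A e (λ v∈K → proj₁ (proj₂ sep) _ v∈K v∈Y))

    Nbh-side-separator : Separator G X Y (Nbh G (side Y K))
    Nbh-side-separator = Nbh-separator X⊆side Y∩side
      (λ v v∈N v∈Y → proj₁ (proj₂ sep) v (Nbh-side⊆ v∈N) v∈Y)

    minimal⇒Nbh-side : (∀ K' → K' ⊂ K → ¬ Separator G X Y K') → K ≡ Nbh G (side Y K)
    minimal⇒Nbh-side minimal = ⊆-antisym K⊆N Nbh-side⊆
      where
      K⊆N : K ⊆ Nbh G (side Y K)
      K⊆N {x} x∈K with x ∈? Nbh G (side Y K)
      ... | yes x∈N = x∈N
      ... | no x∉N  = ⊥-elim (minimal _ (Nbh-side⊆ , x , x∈K , x∉N) Nbh-side-separator)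

  Nbh-submodular : ∀ A B → ∣ Nbh G (A ∪ B) ∣ + ∣ Nbh G (A ∩ B) ∣ ≤ ∣ Nbh G A ∣ + ∣ Nbh G B ∣
  Nbh-submodular A B = card-submodular _ _ _ _ in-both from-∪ from-∩
    where
    from-∪ : ∀ {v} → v ∈ Nbh G (A ∪ B) → v ∈ Nbh G A ⊎ v ∈ Nbh G B
    from-∪ v∈N with Nbh-elim v∈N
    ... | v∉C , u , u∈C , e with x∈p∪q⁻ A B u∈C
    ... | inj₁ u∈A = inj₁ (Nbh-intro (λ v∈A → v∉C (x∈p∪q⁺ (inj₁ v∈A))) u∈A e)
    ... | inj₂ u∈B = inj₂ (Nbh-intro (λ v∈B → v∉C (x∈p∪q⁺ (inj₂ v∈B))) u∈B e)
    from-∩ : ∀ {v} → v ∈ Nbh G (A ∩ B) → v ∈ Nbh G A ⊎ v ∈ Nbh G B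
    from-∩ {v} v∈N with Nbh-elim v∈N | v ∈? A
    ... | v∉I , u , u∈I , e | yes v∈A =
      inj₂ (Nbh-intro (λ v∈B → v∉I (x∈p∩q⁺ (v∈A , v∈B))) (proj₂ (x∈p∩q⁻ A B u∈I)) e)
    ... | _ , u , u∈I , e | no v∉A = inj₁ (Nbh-intro v∉A (proj₁ (x∈p∩q⁻ A B u∈I)) e)
    in-both : ∀ {v} → v ∈ Nbh G (A ∪ B) → v ∈ Nbh G (A ∩ B) → v ∈ Nbh G A × v ∈ Nbh G B
    in-both v∈N∪ v∈N∩ with Nbh-elim v∈N∪ | Nbh-elim v∈N∩
    ... | v∉C , _ | _ , u , u∈I , e =
      Nbh-intro (λ v∈A → v∉C (x∈p∪q⁺ (inj₁ v∈A))) (proj₁ (x∈p∩q⁻ A B u∈I)) e ,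
      Nbh-intro (λ v∈B → v∉C (x∈p∪q⁺ (inj₂ v∈B))) (proj₂ (x∈p∩q⁻ A B u∈I)) e

  disjoint? : ∀ A B → Dec (Disjoint G A B)
  disjoint? A B = all? λ v → (v ∈? A) →-dec ¬? (v ∈? B)

  separator? : ∀ X Y K → Dec (Separator G X Y K)
  separator? X Y K = disjoint? K X ×-dec disjoint? K Y ×-dec
    ¬? (any? λ a → any? λ b → (a ∈? X) ×-dec (b ∈? Y) ×-dec walk? K a b)

  sides-avoid-Y : ∀ {X Y K₁ K₂} → Separator G X Y K₁ → Separator G X Y K₂ →
    Disjoint G Y (side Y K₁ ∪ side Y K₂)
  sides-avoid-Y s₁ s₂ y y∈Y y∈C with x∈p∪q⁻ _ _ y∈C
  ... | inj₁ y∈A₁ = Side.Y∩side s₁ y y∈Y y∈A₁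
  ... | inj₂ y∈A₂ = Side.Y∩side s₂ y y∈Y y∈A₂

  -- Any C with X ⊆ C ⊆ side K₁ ∪ side K₂ has N(C) as an X–Y separator; this
  -- covers both the union and the intersection of the two sides.
  squeezed-separator : ∀ {X Y K₁ K₂ C} → Separator G X Y K₁ → Separator G X Y K₂ →
    X ⊆ C → C ⊆ side Y K₁ ∪ side Y K₂ → Separator G X Y (Nbh G C)
  squeezed-separator {Y = Y} {C = C} s₁ s₂ X⊆C C⊆ = Nbh-separator X⊆C
    (λ y y∈Y y∈C → sides-avoid-Y s₁ s₂ y y∈Y (C⊆ y∈C)) N∩Y
    where
    N∩Y : Disjoint G (Nbh G C) Y
    N∩Y v v∈N v∈Y with Nbh-elim v∈N
    ... | _ , u , u∈C , e with x∈p∪q⁻ _ _ (C⊆ u∈C)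
    ... | inj₁ u∈A₁ = Side.no-edge-to-Y s₁ u∈A₁ v∈Y e
    ... | inj₂ u∈A₂ = Side.no-edge-to-Y s₂ u∈A₂ v∈Y e

  Nbh-greater : ∀ {Y K C} v → Disjoint G Y C → side Y K ⊆ C → v ∈ C → v ∉ side Y K →
    Greater G Y (Nbh G C) K
  Nbh-greater {Y} {K} v Y∩C A⊆C v∈C v∉A =
    (λ _ nr → NR-Nbh Y∩C (A⊆C (∈⟦⟧⁺ (NR? Y K) nr))) ,
    v , NR-Nbh Y∩C v∈C , λ nr → v∉A (∈⟦⟧⁺ (NR? Y K) nr)

  greater⇒side⊂ : ∀ {Y K K'} → Greater G Y K' K → side Y K ⊂ side Y K'
  greater⇒side⊂ {Y} {K} {K'} (grows , v , nr' , ¬nr) =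
    (λ w∈A → ∈⟦⟧⁺ (NR? Y K') (grows _ (∈⟦⟧⁻ (NR? Y K) w∈A))) ,
    v , ∈⟦⟧⁺ (NR? Y K') nr' , λ v∈A → ¬nr (∈⟦⟧⁻ (NR? Y K) v∈A)

  min-size-unique : ∀ {X Y r r'} → MinSepSize G X Y r → MinSepSize G X Y r' → r ≡ r'
  min-size-unique ((K , sK , refl) , least) ((K' , sK' , refl) , least') =
    ≤-antisym (least K' sK') (least' K sK)

  SmallestAvoiding : Subset n → Subset n → Subset n → Subset n → Set
  SmallestAvoiding X Y S K = Separator G X Y K × Disjoint G S K ×
    (∀ K' → Separator G X Y K' → Disjoint G S K' → ∣ K ∣ ≤ ∣ K' ∣)

  witness⇒smallest : ∀ {X Y S K} → Witness G X Y S K → SmallestAvoiding X Y S K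
  witness⇒smallest {K = K} (sK , dK , _ , (K₀ , (s₀ , _ , least₀) , (_ , _ , ms₀ , c≡)) , (_ , _ , ms , c≡′))
    with min-size-unique ms₀ ms
  ... | refl = sK , dK , λ K' s' d' → subst (_≤ ∣ K' ∣) same-size (least₀ K' s' d')
    where
    same-size : ∣ K₀ ∣ ≡ ∣ K ∣
    same-size = ∸-cancelʳ-≡ (proj₂ ms K₀ s₀) (proj₂ ms K sK) (trans (sym c≡) c≡′)

  smallest⇒witness : ∀ {X Y S K r} → MinSepSize G X Y r → SmallestAvoiding X Y S K →
    Witness G X Y S K
  smallest⇒witness {K = K} {r} ms smallest@(sK , dK , _) =
    sK , dK , ∣ K ∣ ∸ r , (K , smallest , (sK , r , ms , refl)) , (sK , r , ms , refl)

  -- A smallest separator avoiding S has no proper sub-separator (which would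
  -- also avoid S).
  smallest⇒minimal : ∀ {X Y S K} → SmallestAvoiding X Y S K → MinimalSeparator G X Y K
  smallest⇒minimal (sK , dK , least) =
    sK , λ K' K'⊂K@(K'⊆K , _) sK' →
      <⇒≱ (p⊂q⇒∣p∣<∣q∣ K'⊂K) (least K' sK' (λ s s∈S s∈K' → dK s s∈S (K'⊆K s∈K')))

  Nbh-X⊆side : ∀ {X Y K S} → Separator G X Y K → S ⊆ Nbh G X → Disjoint G S K → S ⊆ side Y K
  Nbh-X⊆side sK S⊆NX dK {s} s∈S with Nbh-elim (S⊆NX s∈S)
  ... | _ , u , u∈X , e = Side.side-closed sK (Side.X⊆side sK u∈X) e (dK s s∈S)

  module Normalized-setting (X Y S : Subset n) (X∩Y : Disjoint G X Y)
    (normalized : Normalized G X Y) (S⊆NX : S ⊆ Nbh G X)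
    (S≁Y : ∀ s y → s ∈ S → y ∈ Y → adj G s y ≡ false) where

    ImportantWitnessOfS : Subset n → Set
    ImportantWitnessOfS = ImportantWitness G X Y S

    Nbh-X-separator : Separator G X Y (Nbh G X)
    Nbh-X-separator = proj₁ (proj₁ normalized)

    min-size : MinSepSize G X Y ∣ Nbh G X ∣
    min-size = (Nbh G X , Nbh-X-separator , refl) , proj₂ (proj₁ normalized)

    -- N(Y) is a separator avoiding S, so separators avoiding S exist.
    Nbh-Y-separator : Separator G X Y (Nbh G Y)
    Nbh-Y-separator = separator-sym (Nbh-separator (λ y∈Y → y∈Y) X∩Y N∩X)
      where
      N∩X : Disjoint G (Nbh G Y) X
      N∩X v v∈N v∈X with Nbh-elim v∈N
      ... | _ , u , u∈Y , e =
        proj₁ (proj₂ Nbh-X-separator) u (Nbh-intro (λ u∈X → X∩Y u u∈X u∈Y) v∈X (adj-sym e)) u∈Y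

    S∩Nbh-Y : Disjoint G S (Nbh G Y)
    S∩Nbh-Y s s∈S s∈N with Nbh-elim s∈N
    ... | _ , u , u∈Y , e with trans (sym (S≁Y s u s∈S u∈Y)) (adj-sym e)
    ... | ()

    side-maximal : ∀ {K₁ K₂} → ImportantWitnessOfS K₁ → ImportantWitnessOfS K₂ →
      side Y K₂ ⊆ side Y K₁
    side-maximal {K₁} {K₂} ((s₁ , d₁ , _) , _ , unimprovable) (W₂@(s₂ , d₂ , _) , _) {v} v∈A₂
      with v ∈? side Y K₁
    ... | yes v∈A₁ = v∈A₁
    ... | no v∉A₁ = ⊥-elim (unimprovable (Nbh G (A₁ ∪ A₂) , ∪-separator ,
            Nbh-greater v (sides-avoid-Y s₁ s₂) (p⊆p∪q A₂) (x∈p∪q⁺ (inj₂ v∈A₂)) v∉A₁ , ∪-small))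
      where
      A₁ A₂ : Subset n
      A₁ = side Y K₁
      A₂ = side Y K₂
      ∪-separator : Separator G X Y (Nbh G (A₁ ∪ A₂))
      ∪-separator = squeezed-separator s₁ s₂ (λ x∈X → x∈p∪q⁺ (inj₁ (Side.X⊆side s₁ x∈X))) (λ v → v)
      ∩-separator : Separator G X Y (Nbh G (A₁ ∩ A₂))
      ∩-separator = squeezed-separator s₁ s₂
        (λ x∈X → x∈p∩q⁺ (Side.X⊆side s₁ x∈X , Side.X⊆side s₂ x∈X))
        (λ w∈I → x∈p∪q⁺ (inj₁ (proj₁ (x∈p∩q⁻ A₁ A₂ w∈I))))
      S∩Nbh-∩ : Disjoint G S (Nbh G (A₁ ∩ A₂))
      S∩Nbh-∩ s s∈S s∈N = proj₁ (Nbh-elim s∈N)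
        (x∈p∩q⁺ (Nbh-X⊆side s₁ S⊆NX d₁ s∈S , Nbh-X⊆side s₂ S⊆NX d₂ s∈S))
      ∪-small : ∣ Nbh G (A₁ ∪ A₂) ∣ ≤ ∣ K₁ ∣
      ∪-small = +-cancelʳ-≤ _ _ _ (begin
        ∣ Nbh G (A₁ ∪ A₂) ∣ + ∣ K₂ ∣
          ≤⟨ +-monoʳ-≤ ∣ Nbh G (A₁ ∪ A₂) ∣
               (proj₂ (proj₂ (witness⇒smallest W₂)) _ ∩-separator S∩Nbh-∩) ⟩
        ∣ Nbh G (A₁ ∪ A₂) ∣ + ∣ Nbh G (A₁ ∩ A₂) ∣
          ≤⟨ Nbh-submodular A₁ A₂ ⟩
        ∣ Nbh G A₁ ∣ + ∣ Nbh G A₂ ∣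
          ≤⟨ +-mono-≤ (p⊆q⇒∣p∣≤∣q∣ (Side.Nbh-side⊆ s₁)) (p⊆q⇒∣p∣≤∣q∣ (Side.Nbh-side⊆ s₂)) ⟩
        ∣ K₁ ∣ + ∣ K₂ ∣ ∎)
        where open ≤-Reasoning

    -- Minimal separators are determined by their sides, which coincide here.
    unique : ∀ {K₁ K₂} → ImportantWitnessOfS K₁ → ImportantWitnessOfS K₂ → K₁ ≡ K₂
    unique {K₁} {K₂} w₁@(_ , (s₁ , minimal₁) , _) w₂@(_ , (s₂ , minimal₂) , _) = begin
      K₁                 ≡⟨ Side.minimal⇒Nbh-side s₁ minimal₁ ⟩
      Nbh G (side Y K₁)  ≡⟨ cong (Nbh G) (⊆-antisym (side-maximal w₂ w₁) (side-maximal w₁ w₂)) ⟩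
      Nbh G (side Y K₂)  ≡⟨ sym (Side.minimal⇒Nbh-side s₂ minimal₂) ⟩
      K₂                 ∎
      where open ≡-Reasoning

    Avoiding : Subset n → Set
    Avoiding K = Separator G X Y K × Disjoint G S K

    avoiding? : Decidable Avoiding
    avoiding? K = separator? X Y K ×-dec disjoint? S K

    -- Starting from N(Y), descend to a separator of least size avoiding S.
    smallest-avoiding : ∃ (SmallestAvoiding X Y S)
    smallest-avoiding
      with ≺-minimal avoiding? (λ a b → ∣ a ∣ <? ∣ b ∣) ∣_∣ (λ a<b → a<b)
             (Nbh-Y-separator , S∩Nbh-Y)
    ... | K₀ , (s₀ , d₀) , none-smaller =
      K₀ , s₀ , d₀ , λ K' s' d' → ≮⇒≥ (none-smaller K' (s' , d'))

    -- Among the smallest separators avoiding S, one with an inclusion-maximal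
    -- side is an important witness.
    exists : ∃ ImportantWitnessOfS
    exists with smallest-avoiding
    ... | K₀ , s₀ , d₀ , least₀
      with ≺-minimal (λ K → avoiding? K ×-dec (∣ K ∣ ≤? ∣ K₀ ∣))
             (λ a b → side Y b ⊂? side Y a) (λ K → n ∸ ∣ side Y K ∣)
             (λ {a} {b} b⊂a → ∸-monoʳ-< (p⊂q⇒∣p∣<∣q∣ b⊂a) (∣p∣≤n (side Y a)))
             ((s₀ , d₀) , ≤-refl)
    ... | K , ((sK , dK) , K≤K₀) , no-larger-side =
      K , (smallest⇒witness min-size smallest , smallest⇒minimal smallest , unimprovable)
      where
      smallest : SmallestAvoiding X Y S K
      smallest = sK , dK , λ K' s' d' → ≤-trans K≤K₀ (least₀ K' s' d')
      unimprovable : ¬ (Σ (Subset n) λ K' → Separator G X Y K' × Greater G Y K' K × ∣ K' ∣ ≤ ∣ K ∣)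
      unimprovable (K' , s' , K'>K@(grows , _) , K'≤K) =
        no-larger-side K' ((s' , d') , ≤-trans K'≤K K≤K₀) (greater⇒side⊂ K'>K)
        where
        d' : Disjoint G S K'
        d' s s∈S = proj₁ (grows s (∈⟦⟧⁻ (NR? Y K) (Nbh-X⊆side sK S⊆NX dK s∈S)))

lemma10 : {n : ℕ} (G : Graph n) (X Y S : Subset n) →
    Disjoint G X Y →
    Normalized G X Y →
    S ⊆ Nbh G X →
    (∀ s y → s ∈ S → y ∈ Y → adj G s y ≡ false) →
    Σ (Subset n) λ K → ImportantWitness G X Y S K ×
      (∀ K' → ImportantWitness G X Y S K' → K' ≡ K)
lemma10 G X Y S X∩Y normalized S⊆NX S≁Y =
  let (K , witness) = exists in K , witness , λ K' witness' → unique witness' witness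
  where open Normalized-setting G X Y S X∩Y normalized S⊆NX S≁Y
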